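{- For every positive integer $n$, there exists a simple connected $(4n-1)$-regular graph on $12n-2$ vertices having an edge $e$ such that $G-e$ has exactly two connected components, each of order $6n-1$. -}

module Defs where

open import Data.Nat using (ℕ; suc)
open import Data.Bool using (Bool; true; false; _∧_; _∨_; not)
open import Data.Bool.Properties using (∧-comm; ∨-comm)
open import Data.Fin using (_≟_)
open import Relation.Nullary.Decidable using (⌊_⌋)
open import Data.Fin using (Fin)
open import Data.Fin.Subset using (Subset; _∈_; ∣_∣)
open import Data.Vec using (tabulate)
open import Data.Product using (_×_; Σ)
open import Data.Empty using (⊥)
open import Relation.Binary.PropositionalEquality using (_≡_; _≢_; trans; cong; cong₂)
open import Relation.Nullary using (¬_)
open import Function.Bundles using (_⇔_)

record SimpleGraph (V : ℕ) : Set where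
  field
    adj       : Fin V → Fin V → Bool
    symmetric : ∀ x y → adj x y ≡ adj y x
    loopless  : ∀ x → adj x x ≡ false
open SimpleGraph public

neighbours : ∀ {V} → SimpleGraph V → Fin V → Subset V
neighbours G x = tabulate (adj G x)

degree : ∀ {V} → SimpleGraph V → Fin V → ℕ
degree G x = ∣ neighbours G x ∣

Regular : ∀ {V} → ℕ → SimpleGraph V → Set
Regular k G = ∀ x → degree G x ≡ k

data Reach {V : ℕ} (G : SimpleGraph V) : Fin V → Fin V → Set where
  here : ∀ {x} → Reach G x x
  step : ∀ {x y z} → adj G x y ≡ true → Reach G y z → Reach G x z

Connected : ∀ {V} → SimpleGraph V → Set
Connected G = ∀ x y → Reach G x y

IsComponentOf : ∀ {V} → SimpleGraph V → Fin V → Subset V → Set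
IsComponentOf G x S = ∀ y → (y ∈ S) ⇔ Reach G x y

IsEdge : ∀ {V} → SimpleGraph V → Fin V → Fin V → Set
IsEdge G x y = adj G x y ≡ true

isUV : ∀ {V} → Fin V → Fin V → Fin V → Fin V → Bool
isUV u v x y = (⌊ x ≟ u ⌋ ∧ ⌊ y ≟ v ⌋) ∨ (⌊ x ≟ v ⌋ ∧ ⌊ y ≟ u ⌋)

isUV-sym : ∀ {V} (u v x y : Fin V) → isUV u v x y ≡ isUV u v y x
isUV-sym u v x y =
  trans (∨-comm (⌊ x ≟ u ⌋ ∧ ⌊ y ≟ v ⌋) _)
        (cong₂ _∨_ (∧-comm ⌊ x ≟ v ⌋ ⌊ y ≟ u ⌋) (∧-comm ⌊ x ≟ u ⌋ ⌊ y ≟ v ⌋))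

deleteEdge : ∀ {V} → SimpleGraph V → Fin V → Fin V → SimpleGraph V
deleteEdge G u v = record
  { adj       = λ x y → adj G x y ∧ not (isUV u v x y)
  ; symmetric = λ x y → cong₂ (λ a b → a ∧ not b) (symmetric G x y) (isUV-sym u v x y)
  ; loopless  = λ x → cong (λ a → a ∧ not (isUV u v x x)) (loopless G x)
  }

-- Let H be the graph made of a hub joined to two disjoint cliques A and B of
-- order 2n - 1, every vertex of A ∪ B joined to every vertex of W₁ ∪ W₂, and a
-- perfect matching between W₁ and W₂, both of order n. It is connected, has
-- 6n - 1 vertices, and every vertex has degree 4n - 1 except the hub, which
-- has degree 4n - 2. Two copies of H joined by an edge between their hubs form
-- a connected (4n - 1)-regular graph on 12n - 2 vertices, and deleting that
-- edge leaves exactly the two copies: no other edge crosses between them.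
module Submission where

open import Defs
open import Data.Nat using (ℕ; zero; suc; _+_; _*_; _∸_; _≤_)
open import Data.Nat.Properties using (+-assoc; +-comm; +-suc; +-identityʳ)
open import Data.Nat.Tactic.RingSolver using (solve-∀)
open import Data.Bool using (Bool; true; false; _∧_; not)
open import Data.Bool.Properties using (∧-zeroʳ; ∧-identityʳ)
open import Data.Fin using (Fin; zero; suc; _≟_; _↑ˡ_; _↑ʳ_; splitAt; join)
open import Data.Fin.Properties
  using (suc-injective; splitAt-↑ˡ; splitAt-↑ʳ; splitAt-join; join-splitAt; splitAt⁻¹-↑ˡ; splitAt⁻¹-↑ʳ)
open import Data.Fin.Subset using (_∈_; ∣_∣)
open import Data.Maybe using (is-just)
open import Data.Product using (Σ; _×_; _,_; ∃-syntax)
open import Data.Sum using (_⊎_; inj₁; inj₂; [_,_]′; isInj₁; swap)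
import Data.Sum as Sum
open import Data.Vec using ([]; _∷_; tabulate)
open import Data.Vec.Properties using (lookup∘tabulate; []=⇒lookup; lookup⇒[]=; tabulate-cong)
open import Function using (_∘_; const)
open import Function.Bundles using (_⇔_; mk⇔; Equivalence)
open import Relation.Nullary using (¬_; yes; no; contradiction)
open import Relation.Nullary.Decidable using (⌊_⌋; isYes≗does; dec-true; dec-false; ⌊⌋-map′)
open import Relation.Binary.PropositionalEquality
  using (_≡_; _≢_; refl; sym; trans; cong; cong₂; subst; subst₂)

private
  variable
    n p q : ℕ

⌊≟⌋-refl : (i : Fin n) → ⌊ i ≟ i ⌋ ≡ true
⌊≟⌋-refl i = trans (isYes≗does (i ≟ i)) (dec-true (i ≟ i) refl)

⌊≟⌋-≢ : {i j : Fin n} → i ≢ j → ⌊ i ≟ j ⌋ ≡ false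
⌊≟⌋-≢ {i = i} {j} i≢j = trans (isYes≗does (i ≟ j)) (dec-false (i ≟ j) i≢j)

⌊≟⌋-sym : (i j : Fin n) → ⌊ i ≟ j ⌋ ≡ ⌊ j ≟ i ⌋
⌊≟⌋-sym i j with i ≟ j
... | yes refl = sym (⌊≟⌋-refl i)
... | no i≢j   = sym (⌊≟⌋-≢ (i≢j ∘ sym))

⌊suc≟suc⌋ : (i j : Fin n) → ⌊ suc i ≟ suc j ⌋ ≡ ⌊ i ≟ j ⌋
⌊suc≟suc⌋ i j = ⌊⌋-map′ (cong suc) suc-injective (i ≟ j)

↑ˡ≢↑ʳ : (i : Fin p) (j : Fin q) → i ↑ˡ q ≢ p ↑ʳ j
↑ˡ≢↑ʳ {p} {q} i j eq
  with () ← trans (sym (splitAt-↑ˡ p i q)) (trans (cong (splitAt p) eq) (splitAt-↑ʳ p q j))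

∈-tabulate⇔ : {f : Fin n → Bool} {x : Fin n} → x ∈ tabulate f ⇔ f x ≡ true
∈-tabulate⇔ {f = f} {x} = mk⇔
  (λ x∈ → trans (sym (lookup∘tabulate f x)) ([]=⇒lookup x∈))
  (λ fx → lookup⇒[]= x (tabulate f) (trans (lookup∘tabulate f x) fx))

∣tabulate-false∣≡0 : ∀ n → ∣ tabulate {n = n} (const false) ∣ ≡ 0
∣tabulate-false∣≡0 zero    = refl
∣tabulate-false∣≡0 (suc n) = ∣tabulate-false∣≡0 n

∣tabulate-true∣≡n : ∀ n → ∣ tabulate {n = n} (const true) ∣ ≡ n
∣tabulate-true∣≡n zero    = refl
∣tabulate-true∣≡n (suc n) = cong suc (∣tabulate-true∣≡n n)

∣tabulate-≟∣≡1 : (i : Fin n) → ∣ tabulate (λ j → ⌊ i ≟ j ⌋) ∣ ≡ 1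
∣tabulate-≟∣≡1 {suc n} zero    = cong suc (∣tabulate-false∣≡0 n)
∣tabulate-≟∣≡1 {suc n} (suc i) =
  trans (cong ∣_∣ (tabulate-cong (⌊suc≟suc⌋ i))) (∣tabulate-≟∣≡1 i)

∣tabulate-≢∣≡n : (i : Fin (suc n)) → ∣ tabulate (λ j → not ⌊ i ≟ j ⌋) ∣ ≡ n
∣tabulate-≢∣≡n {n}     zero    = ∣tabulate-true∣≡n n
∣tabulate-≢∣≡n {suc n} (suc i) =
  cong suc (trans (cong ∣_∣ (tabulate-cong (cong not ∘ ⌊suc≟suc⌋ i))) (∣tabulate-≢∣≡n i))

∣tabulate∘splitAt∣ : ∀ p (f : Fin p ⊎ Fin q → Bool) →
  ∣ tabulate (f ∘ splitAt p) ∣ ≡ ∣ tabulate (f ∘ inj₁) ∣ + ∣ tabulate (f ∘ inj₂) ∣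
∣tabulate∘splitAt∣ zero    f = refl
∣tabulate∘splitAt∣ (suc p) f with f (inj₁ zero)
... | true  = cong suc (∣tabulate∘splitAt∣ p (f ∘ Sum.map₁ suc))
... | false = ∣tabulate∘splitAt∣ p (f ∘ Sum.map₁ suc)

module _ {V} (G : SimpleGraph V) where

  reach-trans : ∀ {x y z} → Reach G x y → Reach G y z → Reach G x z
  reach-trans here         r = r
  reach-trans (step e r′) r = step e (reach-trans r′ r)

  reach-sym : ∀ {x y} → Reach G x y → Reach G y x
  reach-sym here                = here
  reach-sym (step {x} {y} e r) = reach-trans (reach-sym r) (step (trans (symmetric G y x) e) here)

  connected-via : (r : Fin V) → (∀ x → Reach G x r) → Connected G
  connected-via r toR x y = reach-trans (toR x) (reach-sym (toR y))

  reach-invariant : {A : Set} (f : Fin V → A) → (∀ x y → IsEdge G x y → f x ≡ f y) →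
                    ∀ {x y} → Reach G x y → f x ≡ f y
  reach-invariant f inv here                = refl
  reach-invariant f inv (step {x} {y} e r) = trans (inv x y e) (reach-invariant f inv r)

  colour-component : (c : Fin V → Bool) → (∀ x y → IsEdge G x y → c x ≡ c y) →
                     ∀ {u v} → (∀ x → Reach G u x ⊎ Reach G v x) → c u ≡ true → c v ≡ false →
                     IsComponentOf G u (tabulate c)
  colour-component c inv {u} {v} reachable cu cv y =
    mk⇔ (to ∘ Equivalence.to ∈-tabulate⇔)
        (λ r → Equivalence.from ∈-tabulate⇔ (trans (sym (reach-invariant c inv r)) cu))
    where
    to : c y ≡ true → Reach G u y
    to cy with reachable y
    ... | inj₁ r = r
    ... | inj₂ r with () ← trans (sym cv) (trans (reach-invariant c inv r) cy)

reach-mono : ∀ {V} {G G′ : SimpleGraph V} → (∀ {x y} → IsEdge G x y → IsEdge G′ x y) →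
             ∀ {x y} → Reach G x y → Reach G′ x y
reach-mono G⊆G′ here       = here
reach-mono G⊆G′ (step e r) = step (G⊆G′ e) (reach-mono G⊆G′ r)

deleteEdge-⊆ : ∀ {V} (G : SimpleGraph V) u v {x y} → IsEdge (deleteEdge G u v) x y → IsEdge G x y
deleteEdge-⊆ G u v {x} {y} e with adj G x y
... | true = refl

glueAdj : SimpleGraph p → SimpleGraph q → (Fin p → Fin q → Bool) →
          Fin p ⊎ Fin q → Fin p ⊎ Fin q → Bool
glueAdj H₁ H₂ cross (inj₁ i) (inj₁ j) = adj H₁ i j
glueAdj H₁ H₂ cross (inj₁ i) (inj₂ j) = cross i j
glueAdj H₁ H₂ cross (inj₂ j) (inj₁ i) = cross i j
glueAdj H₁ H₂ cross (inj₂ i) (inj₂ j) = adj H₂ i j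

glueAdj-sym : (H₁ : SimpleGraph p) (H₂ : SimpleGraph q) (cross : Fin p → Fin q → Bool) →
              ∀ a b → glueAdj H₁ H₂ cross a b ≡ glueAdj H₁ H₂ cross b a
glueAdj-sym H₁ H₂ cross (inj₁ i) (inj₁ j) = symmetric H₁ i j
glueAdj-sym H₁ H₂ cross (inj₁ i) (inj₂ j) = refl
glueAdj-sym H₁ H₂ cross (inj₂ j) (inj₁ i) = refl
glueAdj-sym H₁ H₂ cross (inj₂ i) (inj₂ j) = symmetric H₂ i j

glueAdj-loop : (H₁ : SimpleGraph p) (H₂ : SimpleGraph q) (cross : Fin p → Fin q → Bool) →
               ∀ a → glueAdj H₁ H₂ cross a a ≡ false
glueAdj-loop H₁ H₂ cross (inj₁ i) = loopless H₁ i
glueAdj-loop H₁ H₂ cross (inj₂ i) = loopless H₂ i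

glue : SimpleGraph p → SimpleGraph q → (Fin p → Fin q → Bool) → SimpleGraph (p + q)
glue {p} H₁ H₂ cross = record
  { adj       = λ x y → glueAdj H₁ H₂ cross (splitAt p x) (splitAt p y)
  ; symmetric = λ x y → glueAdj-sym H₁ H₂ cross (splitAt p x) (splitAt p y)
  ; loopless  = λ x → glueAdj-loop H₁ H₂ cross (splitAt p x)
  }

disjointUnion : SimpleGraph p → SimpleGraph q → SimpleGraph (p + q)
disjointUnion H₁ H₂ = glue H₁ H₂ (λ _ _ → false)

singleEdge : Fin p → Fin q → Fin p → Fin q → Bool
singleEdge s t i j = ⌊ s ≟ i ⌋ ∧ ⌊ t ≟ j ⌋

bridge : SimpleGraph p → Fin p → SimpleGraph q → Fin q → SimpleGraph (p + q)
bridge H₁ s H₂ t = glue H₁ H₂ (singleEdge s t)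

inLeft : ∀ p → Fin (p + q) → Bool
inLeft p = is-just ∘ isInj₁ ∘ splitAt p

module _ {H₁ : SimpleGraph p} {H₂ : SimpleGraph q} where

  reach-↑ˡ : ∀ {i j} → Reach H₁ i j → Reach (disjointUnion H₁ H₂) (i ↑ˡ q) (j ↑ˡ q)
  reach-↑ˡ here = here
  reach-↑ˡ (step {i} {j} e r) =
    step (trans (cong₂ (glueAdj H₁ H₂ _) (splitAt-↑ˡ p i q) (splitAt-↑ˡ p j q)) e) (reach-↑ˡ r)

  reach-↑ʳ : ∀ {i j} → Reach H₂ i j → Reach (disjointUnion H₁ H₂) (p ↑ʳ i) (p ↑ʳ j)
  reach-↑ʳ here = here
  reach-↑ʳ (step {i} {j} e r) =
    step (trans (cong₂ (glueAdj H₁ H₂ _) (splitAt-↑ʳ p q i) (splitAt-↑ʳ p q j)) e) (reach-↑ʳ r)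

  inLeft-edge : ∀ x y → IsEdge (disjointUnion H₁ H₂) x y → inLeft p x ≡ inLeft p y
  inLeft-edge x y e with splitAt p x | splitAt p y
  inLeft-edge x y e  | inj₁ _ | inj₁ _ = refl
  inLeft-edge x y e  | inj₂ _ | inj₂ _ = refl
  inLeft-edge x y () | inj₁ _ | inj₂ _
  inLeft-edge x y () | inj₂ _ | inj₁ _

  disjointUnion-reach : Connected H₁ → Connected H₂ → (s : Fin p) (t : Fin q) →
    ∀ x → Reach (disjointUnion H₁ H₂) (s ↑ˡ q) x ⊎ Reach (disjointUnion H₁ H₂) (p ↑ʳ t) x
  disjointUnion-reach conn₁ conn₂ s t x with splitAt p x in eq
  ... | inj₁ i = inj₁ (subst (Reach _ _) (splitAt⁻¹-↑ˡ eq) (reach-↑ˡ (conn₁ s i)))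
  ... | inj₂ j = inj₂ (subst (Reach _ _) (splitAt⁻¹-↑ʳ eq) (reach-↑ʳ (conn₂ t j)))

AlmostRegular : ℕ → Fin n → SimpleGraph n → Set
AlmostRegular k s H = degree H s + 1 ≡ k × (∀ i → s ≢ i → degree H i ≡ k)

BridgedRegularGraph : (V k p q : ℕ) → Set
BridgedRegularGraph V k p q =
  Σ (SimpleGraph V) λ G →
    Connected G × Regular k G ×
    ∃[ u ] ∃[ v ] (IsEdge G u v ×
      (∀ x → Reach (deleteEdge G u v) u x ⊎ Reach (deleteEdge G u v) v x) ×
      ¬ Reach (deleteEdge G u v) u v ×
      ∃[ S ] ∃[ T ] (IsComponentOf (deleteEdge G u v) u S ×
                    IsComponentOf (deleteEdge G u v) v T ×
                    ∣ S ∣ ≡ p × ∣ T ∣ ≡ q))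

module _ {H₁ : SimpleGraph p} {H₂ : SimpleGraph q} (s : Fin p) (t : Fin q) where

  private
    G = bridge H₁ s H₂ t
    u = s ↑ˡ q
    v = p ↑ʳ t

  bridge-regular : ∀ {k} → AlmostRegular k s H₁ → AlmostRegular k t H₂ → Regular k G
  bridge-regular {k} (deg-s , deg₁) (deg-t , deg₂) x =
    trans (∣tabulate∘splitAt∣ p (glueAdj H₁ H₂ (singleEdge s t) (splitAt p x)))
          (split (splitAt p x))
    where
    split : ∀ a → ∣ tabulate (glueAdj H₁ H₂ (singleEdge s t) a ∘ inj₁) ∣ +
                  ∣ tabulate (glueAdj H₁ H₂ (singleEdge s t) a ∘ inj₂) ∣ ≡ k
    split (inj₁ i) with s ≟ i
    ... | yes refl = trans (cong (degree H₁ s +_) (∣tabulate-≟∣≡1 t)) deg-s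
    ... | no s≢i   = trans (cong (degree H₁ i +_) (∣tabulate-false∣≡0 q))
                           (trans (+-identityʳ _) (deg₁ i s≢i))
    split (inj₂ j) with t ≟ j
    ... | yes refl = trans (cong (_+ degree H₂ t)
                                 (trans (cong ∣_∣ (tabulate-cong (λ i → ∧-identityʳ ⌊ s ≟ i ⌋)))
                                        (∣tabulate-≟∣≡1 s)))
                           (trans (+-comm 1 _) deg-t)
    ... | no t≢j   = trans (cong (_+ degree H₂ j)
                                 (trans (cong ∣_∣ (tabulate-cong (λ i → ∧-zeroʳ ⌊ s ≟ i ⌋)))
                                        (∣tabulate-false∣≡0 p)))
                           (deg₂ j t≢j)

  bridge-edge : IsEdge G u v
  bridge-edge rewrite splitAt-↑ˡ p s q | splitAt-↑ʳ p q t | ⌊≟⌋-refl s | ⌊≟⌋-refl t = refl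

  deleteEdge-bridge : ∀ x y → adj (deleteEdge G u v) x y ≡ adj (disjointUnion H₁ H₂) x y
  deleteEdge-bridge x y =
    subst₂ (λ x y → adj (deleteEdge G u v) x y ≡ adj (disjointUnion H₁ H₂) x y)
           (join-splitAt p q x) (join-splitAt p q y) (on-join (splitAt p x) (splitAt p y))
    where
    crossing : ∀ i j → singleEdge s t i j ∧ not (isUV u v (i ↑ˡ q) (p ↑ʳ j)) ≡ false
    crossing i j with s ≟ i | t ≟ j
    ... | no _     | _        = refl
    ... | yes _    | no _     = refl
    ... | yes refl | yes refl rewrite ⌊≟⌋-refl u | ⌊≟⌋-refl v = refl

    on-join : ∀ a b → adj (deleteEdge G u v) (join p q a) (join p q b)
                    ≡ adj (disjointUnion H₁ H₂) (join p q a) (join p q b)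
    on-join a b rewrite splitAt-join p q a | splitAt-join p q b = on-sides a b
      where
      on-sides : ∀ a b → glueAdj H₁ H₂ (singleEdge s t) a b ∧ not (isUV u v (join p q a) (join p q b))
                       ≡ glueAdj H₁ H₂ (λ _ _ → false) a b
      on-sides (inj₁ i) (inj₁ j)
        rewrite ⌊≟⌋-≢ (↑ˡ≢↑ʳ j t) | ⌊≟⌋-≢ (↑ˡ≢↑ʳ i t) | ∧-zeroʳ ⌊ i ↑ˡ q ≟ u ⌋
        = ∧-identityʳ _
      on-sides (inj₂ i) (inj₂ j)
        rewrite ⌊≟⌋-≢ (↑ˡ≢↑ʳ s i ∘ sym) | ⌊≟⌋-≢ (↑ˡ≢↑ʳ s j ∘ sym) | ∧-zeroʳ ⌊ p ↑ʳ i ≟ v ⌋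
        = ∧-identityʳ _
      on-sides (inj₁ i) (inj₂ j) = crossing i j
      on-sides (inj₂ j) (inj₁ i) rewrite isUV-sym u v (p ↑ʳ j) (i ↑ˡ q) = crossing i j

  bridge-bridgedRegular : ∀ {k} → Connected H₁ → Connected H₂ →
                          AlmostRegular k s H₁ → AlmostRegular k t H₂ →
                          BridgedRegularGraph (p + q) k p q
  bridge-bridgedRegular conn₁ conn₂ reg₁ reg₂ =
    G , connected , bridge-regular reg₁ reg₂ , u , v , bridge-edge ,
    reachable , u↮v , tabulate (inLeft p) , tabulate (not ∘ inLeft p) ,
    colour-component G-uv (inLeft p) inLeft-edge′ reachable inLeft-u inLeft-v ,
    colour-component G-uv (not ∘ inLeft p) (λ x y → cong not ∘ inLeft-edge′ x y)
                     (swap ∘ reachable) (cong not inLeft-v) (cong not inLeft-u) ,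
    ∣left∣ , ∣right∣
    where
    G-uv = deleteEdge G u v

    reachable : ∀ x → Reach G-uv u x ⊎ Reach G-uv v x
    reachable x = Sum.map (reach-mono unbridge) (reach-mono unbridge)
                          (disjointUnion-reach conn₁ conn₂ s t x)
      where
      unbridge : ∀ {x y} → IsEdge (disjointUnion H₁ H₂) x y → IsEdge G-uv x y
      unbridge {x} {y} = trans (deleteEdge-bridge x y)

    inLeft-edge′ : ∀ x y → IsEdge G-uv x y → inLeft p x ≡ inLeft p y
    inLeft-edge′ x y e = inLeft-edge x y (trans (sym (deleteEdge-bridge x y)) e)

    inLeft-u : inLeft p u ≡ true
    inLeft-u = cong (is-just ∘ isInj₁) (splitAt-↑ˡ p s q)

    inLeft-v : inLeft p v ≡ false
    inLeft-v = cong (is-just ∘ isInj₁) (splitAt-↑ʳ p q t)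

    u↮v : ¬ Reach G-uv u v
    u↮v r
      with () ← trans (sym inLeft-u) (trans (reach-invariant G-uv (inLeft p) inLeft-edge′ r) inLeft-v)

    connected : Connected G
    connected = connected-via G u to-u
      where
      undelete : ∀ {x y} → Reach G-uv x y → Reach G x y
      undelete = reach-mono (deleteEdge-⊆ G u v)
      to-u : ∀ x → Reach G x u
      to-u x with reachable x
      ... | inj₁ r = reach-sym G (undelete r)
      ... | inj₂ r = reach-trans G (reach-sym G (undelete r))
                                   (step (trans (symmetric G v u) bridge-edge) here)

    ∣left∣ : ∣ tabulate (inLeft p) ∣ ≡ p
    ∣left∣ = trans (∣tabulate∘splitAt∣ p (is-just ∘ isInj₁))
                   (trans (cong₂ _+_ (∣tabulate-true∣≡n p) (∣tabulate-false∣≡0 q)) (+-identityʳ p))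

    ∣right∣ : ∣ tabulate (not ∘ inLeft p) ∣ ≡ q
    ∣right∣ = trans (∣tabulate∘splitAt∣ p (not ∘ is-just ∘ isInj₁))
                    (cong₂ _+_ (∣tabulate-false∣≡0 p) (∣tabulate-true∣≡n q))

data HalfVertex (a c : ℕ) : Set where
  hub     : HalfVertex a c
  A B     : Fin a → HalfVertex a c
  W₁ W₂   : Fin c → HalfVertex a c

module _ {a c : ℕ} where

  halfAdj : HalfVertex a c → HalfVertex a c → Bool
  halfAdj hub    hub    = false
  halfAdj hub    (A _)  = true
  halfAdj hub    (B _)  = true
  halfAdj hub    (W₁ _) = false
  halfAdj hub    (W₂ _) = false
  halfAdj (A _)  hub    = true
  halfAdj (A i)  (A j)  = not ⌊ i ≟ j ⌋
  halfAdj (A _)  (B _)  = false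
  halfAdj (A _)  (W₁ _) = true
  halfAdj (A _)  (W₂ _) = true
  halfAdj (B _)  hub    = true
  halfAdj (B _)  (A _)  = false
  halfAdj (B i)  (B j)  = not ⌊ i ≟ j ⌋
  halfAdj (B _)  (W₁ _) = true
  halfAdj (B _)  (W₂ _) = true
  halfAdj (W₁ _) hub    = false
  halfAdj (W₁ _) (A _)  = true
  halfAdj (W₁ _) (B _)  = true
  halfAdj (W₁ _) (W₁ _) = false
  halfAdj (W₁ i) (W₂ j) = ⌊ i ≟ j ⌋
  halfAdj (W₂ _) hub    = false
  halfAdj (W₂ _) (A _)  = true
  halfAdj (W₂ _) (B _)  = true
  halfAdj (W₂ i) (W₁ j) = ⌊ i ≟ j ⌋
  halfAdj (W₂ _) (W₂ _) = false

  halfAdj-sym : ∀ x y → halfAdj x y ≡ halfAdj y x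
  halfAdj-sym hub    hub    = refl
  halfAdj-sym hub    (A _)  = refl
  halfAdj-sym hub    (B _)  = refl
  halfAdj-sym hub    (W₁ _) = refl
  halfAdj-sym hub    (W₂ _) = refl
  halfAdj-sym (A _)  hub    = refl
  halfAdj-sym (A i)  (A j)  = cong not (⌊≟⌋-sym i j)
  halfAdj-sym (A _)  (B _)  = refl
  halfAdj-sym (A _)  (W₁ _) = refl
  halfAdj-sym (A _)  (W₂ _) = refl
  halfAdj-sym (B _)  hub    = refl
  halfAdj-sym (B _)  (A _)  = refl
  halfAdj-sym (B i)  (B j)  = cong not (⌊≟⌋-sym i j)
  halfAdj-sym (B _)  (W₁ _) = refl
  halfAdj-sym (B _)  (W₂ _) = refl
  halfAdj-sym (W₁ _) hub    = refl
  halfAdj-sym (W₁ _) (A _)  = refl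
  halfAdj-sym (W₁ _) (B _)  = refl
  halfAdj-sym (W₁ _) (W₁ _) = refl
  halfAdj-sym (W₁ i) (W₂ j) = ⌊≟⌋-sym i j
  halfAdj-sym (W₂ _) hub    = refl
  halfAdj-sym (W₂ _) (A _)  = refl
  halfAdj-sym (W₂ _) (B _)  = refl
  halfAdj-sym (W₂ i) (W₁ j) = ⌊≟⌋-sym i j
  halfAdj-sym (W₂ _) (W₂ _) = refl

  halfAdj-loop : ∀ x → halfAdj x x ≡ false
  halfAdj-loop hub    = refl
  halfAdj-loop (A i)  = cong not (⌊≟⌋-refl i)
  halfAdj-loop (B i)  = cong not (⌊≟⌋-refl i)
  halfAdj-loop (W₁ _) = refl
  halfAdj-loop (W₂ _) = refl

  decode : Fin (suc (a + (a + (c + c)))) → HalfVertex a c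
  decode zero    = hub
  decode (suc y) = [ A , [ B , [ W₁ , W₂ ]′ ∘ splitAt c ]′ ∘ splitAt a ]′ (splitAt a y)

  decode-suc≢hub : ∀ y → decode (suc y) ≢ hub
  decode-suc≢hub y with splitAt a y
  ... | inj₁ _ = λ ()
  ... | inj₂ z with splitAt a z
  ...   | inj₁ _ = λ ()
  ...   | inj₂ w with splitAt c w
  ...     | inj₁ _ = λ ()
  ...     | inj₂ _ = λ ()

  ∣tabulate∘decode∘suc∣ : (f : HalfVertex a c → Bool) →
    ∣ tabulate (f ∘ decode ∘ suc) ∣
      ≡ ∣ tabulate (f ∘ A) ∣ + (∣ tabulate (f ∘ B) ∣ + (∣ tabulate (f ∘ W₁) ∣ + ∣ tabulate (f ∘ W₂) ∣))
  ∣tabulate∘decode∘suc∣ f =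
    trans (∣tabulate∘splitAt∣ a (f ∘ [ A , [ B , [ W₁ , W₂ ]′ ∘ splitAt c ]′ ∘ splitAt a ]′))
          (cong (∣ tabulate (f ∘ A) ∣ +_)
                (trans (∣tabulate∘splitAt∣ a (f ∘ [ B , [ W₁ , W₂ ]′ ∘ splitAt c ]′))
                       (cong (∣ tabulate (f ∘ B) ∣ +_) (∣tabulate∘splitAt∣ c (f ∘ [ W₁ , W₂ ]′)))))

  ∣tabulate∘decode∣ : (f : HalfVertex a c → Bool) →
    ∣ tabulate (f ∘ decode) ∣
      ≡ ∣ f hub ∷ [] ∣ + (∣ tabulate (f ∘ A) ∣ + (∣ tabulate (f ∘ B) ∣ +
                          (∣ tabulate (f ∘ W₁) ∣ + ∣ tabulate (f ∘ W₂) ∣)))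
  ∣tabulate∘decode∣ f with f hub
  ... | true  = cong suc (∣tabulate∘decode∘suc∣ f)
  ... | false = ∣tabulate∘decode∘suc∣ f

half : (a c : ℕ) → SimpleGraph (suc (a + (a + (c + c))))
half a c = record
  { adj       = λ x y → halfAdj (decode {a} {c} x) (decode y)
  ; symmetric = λ x y → halfAdj-sym (decode {a} {c} x) (decode y)
  ; loopless  = λ x → halfAdj-loop (decode {a} {c} x)
  }

module _ {a c : ℕ} where

  half-connected : Connected (half (suc a) c)
  half-connected = connected-via (half (suc a) c) zero to-hub
    where
    hub-or-A₀ : (x : HalfVertex (suc a) c) → x ≢ hub →
                halfAdj x hub ≡ true ⊎ halfAdj x (A zero) ≡ true
    hub-or-A₀ hub    hub≢hub = contradiction refl hub≢hub
    hub-or-A₀ (A _)  _       = inj₁ refl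
    hub-or-A₀ (B _)  _       = inj₁ refl
    hub-or-A₀ (W₁ _) _       = inj₂ refl
    hub-or-A₀ (W₂ _) _       = inj₂ refl

    to-hub : ∀ x → Reach (half (suc a) c) x zero
    to-hub zero    = here
    to-hub (suc y) with hub-or-A₀ (decode (suc y)) (decode-suc≢hub y)
    ... | inj₁ e = step e here
    ... | inj₂ e = step {y = suc zero} e (step refl here)

  degree-by-class : (x : HalfVertex (suc a) c) {n₁ n₂ n₃ n₄ : ℕ} →
    ∣ tabulate (halfAdj x ∘ A) ∣ ≡ n₁ → ∣ tabulate (halfAdj x ∘ B) ∣ ≡ n₂ →
    ∣ tabulate (halfAdj x ∘ W₁) ∣ ≡ n₃ → ∣ tabulate (halfAdj x ∘ W₂) ∣ ≡ n₄ →
    ∣ tabulate (halfAdj x ∘ decode) ∣ ≡ ∣ halfAdj x hub ∷ [] ∣ + (n₁ + (n₂ + (n₃ + n₄)))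
  degree-by-class x e₁ e₂ e₃ e₄ =
    trans (∣tabulate∘decode∣ (halfAdj x))
          (cong (∣ halfAdj x hub ∷ [] ∣ +_) (cong₂ _+_ e₁ (cong₂ _+_ e₂ (cong₂ _+_ e₃ e₄))))

  half-almostRegular : ∀ {k} → suc (suc a + suc a) ≡ k → suc a + (c + c) ≡ k →
                       AlmostRegular k zero (half (suc a) c)
  half-almostRegular {k} matched≡k clique≡k = hub-degree , other-degree
    where
    matched-degree : suc a + (suc a + 1) ≡ k
    matched-degree =
      trans (cong (suc a +_) (+-comm (suc a) 1)) (trans (+-suc (suc a) (suc a)) matched≡k)

    hub-degree : degree (half (suc a) c) zero + 1 ≡ k
    hub-degree =
      trans (cong (_+ 1) (degree-by-class hub (∣tabulate-true∣≡n (suc a)) (∣tabulate-true∣≡n (suc a))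
                                              (∣tabulate-false∣≡0 c) (∣tabulate-false∣≡0 c)))
            (trans (+-assoc (suc a) (suc a + 0) 1)
                   (trans (cong (λ m → suc a + (m + 1)) (+-identityʳ (suc a))) matched-degree))

    nonhub-degree : (x : HalfVertex (suc a) c) → x ≢ hub → ∣ tabulate (halfAdj x ∘ decode) ∣ ≡ k
    nonhub-degree hub    hub≢hub = contradiction refl hub≢hub
    nonhub-degree (A i)  _ =
      trans (degree-by-class (A i) (∣tabulate-≢∣≡n i) (∣tabulate-false∣≡0 (suc a))
                                   (∣tabulate-true∣≡n c) (∣tabulate-true∣≡n c)) clique≡k
    nonhub-degree (B i)  _ =
      trans (degree-by-class (B i) (∣tabulate-false∣≡0 (suc a)) (∣tabulate-≢∣≡n i)
                                   (∣tabulate-true∣≡n c) (∣tabulate-true∣≡n c)) clique≡k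
    nonhub-degree (W₁ i) _ =
      trans (degree-by-class (W₁ i) (∣tabulate-true∣≡n (suc a)) (∣tabulate-true∣≡n (suc a))
                                    (∣tabulate-false∣≡0 c) (∣tabulate-≟∣≡1 i)) matched-degree
    nonhub-degree (W₂ i) _ =
      trans (degree-by-class (W₂ i) (∣tabulate-true∣≡n (suc a)) (∣tabulate-true∣≡n (suc a))
                                    (∣tabulate-≟∣≡1 i) (∣tabulate-false∣≡0 c)) matched-degree

    other-degree : ∀ x → zero ≢ x → degree (half (suc a) c) x ≡ k
    other-degree zero    0≢0 = contradiction refl 0≢0
    other-degree (suc y) _   = nonhub-degree (decode (suc y)) (decode-suc≢hub y)

lemma6p3 : (n : ℕ) → 1 ≤ n →
    Σ (SimpleGraph (12 * n ∸ 2)) λ G →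
      Connected G × Regular (4 * n ∸ 1) G ×
      ∃[ u ] ∃[ v ] (IsEdge G u v ×
        (∀ x → Reach (deleteEdge G u v) u x ⊎ Reach (deleteEdge G u v) v x) ×
        ¬ Reach (deleteEdge G u v) u v ×
        ∃[ S ] ∃[ T ] (IsComponentOf (deleteEdge G u v) u S ×
                      IsComponentOf (deleteEdge G u v) v T ×
                      ∣ S ∣ ≡ 6 * n ∸ 1 × ∣ T ∣ ≡ 6 * n ∸ 1))
lemma6p3 zero    ()
lemma6p3 (suc m) _ =
  subst₂ (λ V h → BridgedRegularGraph V (4 * suc m ∸ 1) h h)
         (cong (_∸ 2) (twice-order m)) (order m)
         (bridge-bridgedRegular zero zero half-connected half-connected regular regular)
  where
  -- Stated without ∸, which the ring solver does not handle: 6 * suc m ∸ 1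
  -- reduces to m + 5 * suc m, and 4 * suc m ∸ 1 to m + 3 * suc m.
  order : ∀ n → suc (suc (n + n) + (suc (n + n) + (suc n + suc n))) ≡ n + 5 * suc n
  order = solve-∀

  twice-order : ∀ n → let h = suc (suc (n + n) + (suc (n + n) + (suc n + suc n)))
                      in 2 + (h + h) ≡ 12 * suc n
  twice-order = solve-∀

  matched-degree : ∀ n → suc (suc (n + n) + suc (n + n)) ≡ n + 3 * suc n
  matched-degree = solve-∀

  clique-degree : ∀ n → suc (n + n) + (suc n + suc n) ≡ n + 3 * suc n
  clique-degree = solve-∀

  regular : AlmostRegular (4 * suc m ∸ 1) zero (half (suc (m + m)) (suc m))
  regular = half-almostRegular (matched-degree m) (clique-degree m)
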